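{- Fix $1\le i\le n$. (1) Let $\alpha,\alpha'$ be patient instances alive at $i$, of options $j$ and $j'$ respectively, with $j<j'$ and $c(\alpha')\le c(\alpha)$. Then $\alpha'$ remains alive (and patient) at every step at which $\alpha$ is alive, i.e. $e(\alpha')\ge e(\alpha)$; hence $\alpha$ is dead. (2) Let $\alpha,\alpha'$ be impatient instances alive at $i$, of options $j$ and $j'$ respectively, with $j'<j$ and $c(\alpha')\le c(\alpha)$. Then $e(\alpha')\ge e(\alpha)$; hence $\alpha$ is dead.
   Context: Items $1,\ldots,n$ with weights $w_i\ge0$, parameters $s_i\ge0$, and threshold $w_0$. Write $W_{a,b}=\sum_{a\le v\le b}w_v$, $S_{a,b}=\max\{s_v: a\le v\le b\}$, $F[0]=0$, $F[i]=\min\{F[j]+S_{j+1,i}:0\le j<i,\ W_{j+1,i}\le w_0\}$. For $1\le i\le n$ let $O_i=\{j:0\le j<i,\ W_{j+1,i}\le w_0\}$ and $\mathbb{O}_i=\{j\in O_i: j>0,\ s_j>S_{j+1,i}\}$. For $j\in\mathbb{O}_i$ let $\mathrm{next}_i(j)$ be the smallest element of $\mathbb{O}_i$ larger than $j$, or $i$ if there is none. An instance of option $j$ is a pair $\alpha=(j,[a,e])$ where $[a,e]$ is a maximal interval of consecutive indices $i$ such that $j\in\mathbb{O}_i$ for all $i\in[a,e]$ and $\mathrm{next}_i(j)$ is the same for all $i\in[a,e]$ (when $\mathrm{next}_i(j)$ changes, $j$ is said to be renewed and begins a new instance); $\alpha$ is alive at every $i\in[a,e]$, $e(\alpha)=e$,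 and its cost is $c(\alpha)=F[j]+s_{\mathrm{next}_a(j)}$ (constant over $[a,e]$). The instance is patient if $e=n$ or $W_{j+1,e+1}>w_0$ (it exits because of the weight constraint), and impatient otherwise (it exits because $s_j\le s_{e+1}$ or because $\mathrm{next}(j)$ changes). A patient (resp. impatient) instance $\alpha$ alive at $i$ is dead if there is another patient (resp. impatient) instance $\alpha'$ alive at $i$ with $c(\alpha')\le c(\alpha)$ that stays alive at least as long as $\alpha$, i.e. $e(\alpha')\ge e(\alpha)$.
   Formalization: The weights $w_i$, the parameters $s_i$ and the threshold $w_0$ are rational numbers instead of real numbers. -}

module Defs where

open import Data.Nat as ℕ using (ℕ; zero; suc; _∸_)
open import Data.List using (List; []; _∷_; applyUpTo; map; foldr)
open import Data.Rational as ℚ using (ℚ; 0ℚ; _⊔_; _⊓_)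
open import Data.Rational.Properties as ℚP using ()
open import Data.Product using (Σ; _×_; _,_)
open import Data.Sum using (_⊎_)
open import Data.Bool using (if_then_else_)
open import Relation.Nullary using (¬_; does)
open import Relation.Binary.PropositionalEquality using (_≡_)

-- Extended rationals ℚ ∪ {∞} (F[i] is a min over a possibly empty set).

data ℚ∞ : Set where
  fin : ℚ → ℚ∞
  ∞   : ℚ∞

data _≤∞_ : ℚ∞ → ℚ∞ → Set where
  fin≤ : ∀ {x y} → x ℚ.≤ y → fin x ≤∞ fin y
  _≤∞∞ : ∀ x → x ≤∞ ∞

_+∞_ : ℚ∞ → ℚ∞ → ℚ∞
fin x +∞ fin y = fin (x ℚ.+ y)
_     +∞ _     = ∞

_⊓∞_ : ℚ∞ → ℚ∞ → ℚ∞
fin x ⊓∞ fin y = fin (x ⊓ y)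
fin x ⊓∞ ∞     = fin x
∞     ⊓∞ y     = y

min∞ : List ℚ∞ → ℚ∞
min∞ = foldr _⊓∞_ ∞

-- The integer interval [a, b] = a, a+1, …, b  (empty if b < a).

range : ℕ → ℕ → List ℕ
range a b = applyUpTo (a ℕ.+_) (suc b ∸ a)

-- An instance (j, [a, e]) of option j; `nxt` records the common value of
-- next_t(j) for t ∈ [a, e] (it is determined by (j, [a, e])).

record Instance : Set where
  constructor inst
  field
    opt : ℕ
    a   : ℕ
    e   : ℕ
    nxt : ℕ
open Instance public

Alive : Instance → ℕ → Set
Alive α i = a α ℕ.≤ i × i ℕ.≤ e α

SameInstance : Instance → Instance → Set
SameInstance α β = opt α ≡ opt β × a α ≡ a β × e α ≡ e β

module _ (n : ℕ) (w s : ℕ → ℚ) (w₀ : ℚ) where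

  W : ℕ → ℕ → ℚ
  W a b = foldr (λ v acc → w v ℚ.+ acc) 0ℚ (range a b)

  -- S_{a,b} = max{ s_v : a ≤ v ≤ b }  (only used with a ≤ b)
  S : ℕ → ℕ → ℚ
  S a b = foldr (λ v m → s v ⊔ m) (s b) (range a b)

  cand : (ℕ → ℚ∞) → ℕ → ℕ → ℚ∞
  cand G j i = if does (W (suc j) i ℚP.≤? w₀) then G j +∞ fin (S (suc j) i) else ∞

  -- Ftab i k = F[k] for all k ≤ i  (course-of-values recursion)
  Ftab : ℕ → ℕ → ℚ∞
  Ftab zero    k = fin 0ℚ
  Ftab (suc i) k = if does (k ℕ.≤? i) then Ftab i k
                   else min∞ (map (λ j → cand (Ftab i) j (suc i)) (range 0 i))

  -- F[0] = 0, F[i] = min{ F[j] + S_{j+1,i} : 0 ≤ j < i, W_{j+1,i} ≤ w₀ }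
  F : ℕ → ℚ∞
  F i = Ftab i i

  InO : ℕ → ℕ → Set
  InO j i = j ℕ.< i × W (suc j) i ℚ.≤ w₀

  In𝕆 : ℕ → ℕ → Set
  In𝕆 j i = InO j i × 0 ℕ.< j × S (suc j) i ℚ.< s j

  IsNext : ℕ → ℕ → ℕ → Set
  IsNext i j k =
      (j ℕ.< k × In𝕆 k i × (∀ m → j ℕ.< m → m ℕ.< k → ¬ In𝕆 m i))
    ⊎ (k ≡ i × (∀ m → j ℕ.< m → m ℕ.< i → ¬ In𝕆 m i))

  Holds : ℕ → ℕ → ℕ → Set
  Holds j k t = In𝕆 j t × IsNext t j k

  IsInstance : Instance → Set
  IsInstance α =
      1 ℕ.≤ a α × a α ℕ.≤ e α × e α ℕ.≤ n
    × (∀ t → a α ℕ.≤ t → t ℕ.≤ e α → Holds (opt α) (nxt α) t)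
    × (a α ≡ 1 ⊎ (1 ℕ.< a α × ¬ Holds (opt α) (nxt α) (a α ∸ 1)))
    × (e α ≡ n ⊎ (e α ℕ.< n × ¬ Holds (opt α) (nxt α) (suc (e α))))

  cost : Instance → ℚ∞
  cost α = F (opt α) +∞ fin (s (nxt α))

  Patient : Instance → Set
  Patient α = e α ≡ n ⊎ (e α ℕ.< n × w₀ ℚ.< W (suc (opt α)) (suc (e α)))

  Impatient : Instance → Set
  Impatient α = ¬ Patient α

  DeadAmong : (Instance → Set) → Instance → ℕ → Set
  DeadAmong P α i = Σ Instance λ α' →
      IsInstance α' × P α' × Alive α' i × ¬ SameInstance α' α
    × cost α' ≤∞ cost α × e α ℕ.≤ e α'

-- (1) is a weight argument: were α′ to die first, at t = e(α′) + 1 ≤ e(α), then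
-- W_{j′+1,t} > w₀ ≥ W_{j+1,t}, impossible for nonnegative weights since j < j′.
-- (2) is a value argument: were α′ to die first, at t = e′ + 1 ≤ e(α), then j ∈ 𝕆_{e′} ∩ 𝕆_t
-- gives s_t < s_j ≤ S_{m+1,e′} < s_m for every m < j in 𝕆_{e′}; so j′ and next(j′) ≤ j stay
-- in 𝕆_t, no option between them enters, and α′ would still be alive at t.
module Submission where

open import Defs
open import Data.Nat as ℕ using (ℕ; zero; suc; pred; _≤_; _<_; _∸_; _≤′_; z≤n; s≤s; ≤′-refl; ≤′-step)
import Data.Nat.Properties as ℕₚ
open import Data.Rational using (ℚ; 0ℚ; _⊔_; _+_) renaming (_≤_ to _≤ℚ_; _<_ to _<ℚ_)
import Data.Rational.Properties as ℚₚ
open import Data.List using (List; []; _∷_; applyUpTo; foldr)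
open import Data.List.Membership.Propositional using (_∈_)
open import Data.List.Membership.Propositional.Properties using (∈-applyUpTo⁺; ∈-applyUpTo⁻)
open import Data.List.Relation.Unary.All using (All; []; _∷_; tabulate)
open import Data.List.Relation.Unary.Any using (here; there)
open import Data.List.Relation.Binary.Sublist.Propositional using (_⊆_; []; _∷_; _∷ʳ_; ⊆-refl; ⊆-trans; minimum)
open import Data.Product using (_×_; _,_; proj₁; proj₂)
open import Data.Sum using (_⊎_; inj₁; inj₂)
open import Data.Empty using (⊥)
open import Function using (_∘_)
open import Relation.Nullary using (¬_; contradiction)
open import Relation.Binary.PropositionalEquality using (_≡_; _≢_; _≗_; refl; sym; trans; cong; cong₂; subst)

module _ {A : Set} (f : A → ℚ) where

  sumBy : List A → ℚ
  sumBy = foldr (λ v acc → f v + acc) 0ℚ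

  maxBy : ℚ → List A → ℚ
  maxBy = foldr (λ v m → f v ⊔ m)

  sumBy-mono-⊆ : ∀ {xs ys} → All (λ v → 0ℚ ≤ℚ f v) ys → xs ⊆ ys → sumBy xs ≤ℚ sumBy ys
  sumBy-mono-⊆ _ [] = ℚₚ.≤-refl
  sumBy-mono-⊆ {xs} {y ∷ ys} (fy≥0 ∷ p) (y ∷ʳ xs⊆ys) =
    subst (_≤ℚ f y + sumBy ys) (ℚₚ.+-identityˡ (sumBy xs))
          (ℚₚ.+-mono-≤ fy≥0 (sumBy-mono-⊆ p xs⊆ys))
  sumBy-mono-⊆ (_ ∷ p) (refl ∷ xs⊆ys) = ℚₚ.+-monoʳ-≤ (f _) (sumBy-mono-⊆ p xs⊆ys)

  ≤-maxBy : ∀ {x xs} z → x ∈ xs → f x ≤ℚ maxBy z xs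
  ≤-maxBy z (here refl)  = ℚₚ.p≤p⊔q (f _) _
  ≤-maxBy z (there x∈xs) = ℚₚ.p≤q⇒p≤r⊔q (f _) (≤-maxBy z x∈xs)

  maxBy-< : ∀ {z r xs} → z <ℚ r → All (λ v → f v <ℚ r) xs → maxBy z xs <ℚ r
  maxBy-< z<r []         = z<r
  maxBy-< z<r (fx<r ∷ p) = ⊔-< fx<r (maxBy-< z<r p)
    where
    ⊔-< : ∀ {p q r} → p <ℚ r → q <ℚ r → p ⊔ q <ℚ r
    ⊔-< {p} {q} p<r q<r with ℚₚ.⊔-sel p q
    ... | inj₁ p⊔q≡p = subst (_<ℚ _) (sym p⊔q≡p) p<r
    ... | inj₂ p⊔q≡q = subst (_<ℚ _) (sym p⊔q≡q) q<r

module _ {A : Set} where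

  applyUpTo-cong : ∀ {f g : ℕ → A} → f ≗ g → ∀ k → applyUpTo f k ≡ applyUpTo g k
  applyUpTo-cong f≗g zero    = refl
  applyUpTo-cong f≗g (suc k) = cong₂ _∷_ (f≗g 0) (applyUpTo-cong (f≗g ∘ suc) k)

  applyUpTo-⊆ : ∀ (f : ℕ → A) {k m} → k ≤ m → applyUpTo f k ⊆ applyUpTo f m
  applyUpTo-⊆ f {m = m} z≤n = minimum (applyUpTo f m)
  applyUpTo-⊆ f (s≤s k≤m)   = refl ∷ applyUpTo-⊆ (f ∘ suc) k≤m

  applyUpTo-suc-⊆ : ∀ (f : ℕ → A) k → applyUpTo (f ∘ suc) (pred k) ⊆ applyUpTo f k
  applyUpTo-suc-⊆ f zero    = []
  applyUpTo-suc-⊆ f (suc k) = f 0 ∷ʳ ⊆-refl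

∈-range : ∀ {a b v} → a ≤ v → v ≤ b → v ∈ range a b
∈-range {a} {b} {v} a≤v v≤b =
  subst (_∈ range a b) (ℕₚ.m+[n∸m]≡n a≤v)
        (∈-applyUpTo⁺ (a ℕ.+_) (ℕₚ.∸-monoˡ-< (s≤s v≤b) a≤v))

range-bounds : ∀ {a b v} → v ∈ range a b → a ≤ v × v ≤ b
range-bounds {a} {b} v∈ with ∈-applyUpTo⁻ (a ℕ.+_) v∈
... | i , i<len , refl = ℕₚ.m≤m+n a i , a+i≤b
  where
  a≤1+b : a ≤ suc b
  a≤1+b = ℕₚ.<⇒≤ (ℕₚ.m∸n≢0⇒n<m (λ len≡0 → ℕₚ.n≮0 (subst (i <_) len≡0 i<len)))
  a+i≤b : a ℕ.+ i ≤ b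
  a+i≤b = subst (_≤ b) (ℕₚ.+-comm i a) (ℕₚ.≤-pred (ℕₚ.m≤o∸n⇒m+n≤o (suc i) a≤1+b i<len))

All-range : ∀ {P : ℕ → Set} {a b} → (∀ {v} → a ≤ v → v ≤ b → P v) → All P (range a b)
All-range P[a,b] = tabulate (λ v∈ → let a≤v , v≤b = range-bounds v∈ in P[a,b] a≤v v≤b)

range-suc-⊆ : ∀ a b → range (suc a) b ⊆ range a b
range-suc-⊆ a b =
  subst (_⊆ range a b) shift (applyUpTo-suc-⊆ (a ℕ.+_) (suc b ∸ a))
  where
  shift : applyUpTo ((a ℕ.+_) ∘ suc) (pred (suc b ∸ a)) ≡ range (suc a) b
  shift = trans (cong (applyUpTo _) (ℕₚ.pred[m∸n]≡m∸[1+n] (suc b) a))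
                (applyUpTo-cong (ℕₚ.+-suc a) (b ∸ a))

range-⊆ : ∀ {a a′ b b′} → a ≤ a′ → b′ ≤ b → range a′ b′ ⊆ range a b
range-⊆ {a} {a′} {b} {b′} a≤a′ b′≤b =
  ⊆-trans (applyUpTo-⊆ (a′ ℕ.+_) (ℕₚ.∸-monoˡ-≤ a′ (s≤s b′≤b))) (shrink (ℕₚ.≤⇒≤′ a≤a′))
  where
  shrink : ∀ {a′} → a ≤′ a′ → range a′ b ⊆ range a b
  shrink ≤′-refl         = ⊆-refl
  shrink (≤′-step a≤′a′) = ⊆-trans (range-suc-⊆ _ b) (shrink a≤′a′)

module Instances (n : ℕ) (w s : ℕ → ℚ) (w₀ : ℚ) where

  S-upper : ∀ {a b v} → a ≤ v → v ≤ b → s v ≤ℚ S n w s w₀ a b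
  S-upper a≤v v≤b = ≤-maxBy s _ (∈-range a≤v v≤b)

  S-< : ∀ {a b r} → a ≤ b → (∀ {v} → a ≤ v → v ≤ b → s v <ℚ r) → S n w s w₀ a b <ℚ r
  S-< a≤b s<r = maxBy-< s (s<r a≤b ℕₚ.≤-refl) (All-range s<r)

  module _ (w≥0 : ∀ v → 1 ≤ v → v ≤ n → 0ℚ ≤ℚ w v) where

    W-mono : ∀ {a a′ b b′} → 1 ≤ a → a ≤ a′ → b′ ≤ b → b ≤ n →
             W n w s w₀ a′ b′ ≤ℚ W n w s w₀ a b
    W-mono 1≤a a≤a′ b′≤b b≤n =
      sumBy-mono-⊆ w (All-range (λ a≤v v≤b → w≥0 _ (ℕₚ.≤-trans 1≤a a≤v) (ℕₚ.≤-trans v≤b b≤n)))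
                     (range-⊆ a≤a′ b′≤b)

    𝕆-restrict : ∀ {m e} → suc e ≤ n → In𝕆 n w s w₀ m (suc e) → m < e → In𝕆 n w s w₀ m e
    𝕆-restrict {m} 1+e≤n ((_ , W≤w₀) , 0<m , S<sm) m<e =
        (m<e , ℚₚ.≤-trans (W-mono {suc m} (s≤s z≤n) ℕₚ.≤-refl (ℕₚ.n≤1+n _) 1+e≤n) W≤w₀)
      , 0<m
      , S-< m<e (λ m<v v≤e → ℚₚ.≤-<-trans (S-upper m<v (ℕₚ.m≤n⇒m≤1+n v≤e)) S<sm)

    module Step {j e} (1+e≤n : suc e ≤ n)
                (j∈𝕆ₑ : In𝕆 n w s w₀ j e) (j∈𝕆₁₊ₑ : In𝕆 n w s w₀ j (suc e)) where

      j<e : j < e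
      j<e = proj₁ (proj₁ j∈𝕆ₑ)

      s₁₊ₑ<sⱼ : s (suc e) <ℚ s j
      s₁₊ₑ<sⱼ = ℚₚ.≤-<-trans (S-upper (proj₁ (proj₁ j∈𝕆₁₊ₑ)) ℕₚ.≤-refl) (proj₂ (proj₂ j∈𝕆₁₊ₑ))

      stays : ∀ {m} → In𝕆 n w s w₀ m e → m < j → W n w s w₀ (suc m) (suc e) ≤ℚ w₀ →
              In𝕆 n w s w₀ m (suc e)
      stays {m} ((m<e , _) , 0<m , S<sm) m<j W≤w₀ =
        (ℕₚ.m≤n⇒m≤1+n m<e , W≤w₀) , 0<m , S-< (ℕₚ.m≤n⇒m≤1+n m<e) below-sₘ
        where
        below-sₘ : ∀ {v} → suc m ≤ v → v ≤ suc e → s v <ℚ s m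
        below-sₘ m<v v≤1+e with ℕₚ.m≤n⇒m<n∨m≡n v≤1+e
        ... | inj₁ v<1+e = ℚₚ.≤-<-trans (S-upper m<v (ℕₚ.≤-pred v<1+e)) S<sm
        ... | inj₂ refl  = ℚₚ.<-trans s₁₊ₑ<sⱼ (ℚₚ.≤-<-trans (S-upper m<j (ℕₚ.<⇒≤ j<e)) S<sm)

      IsNext-suc : ∀ {j′ k′} → j′ < j → W n w s w₀ (suc j′) (suc e) ≤ℚ w₀ →
                   IsNext n w s w₀ e j′ k′ → IsNext n w s w₀ (suc e) j′ k′
      IsNext-suc j′<j _     (inj₂ (_ , gap)) = contradiction j∈𝕆ₑ (gap _ j′<j j<e)
      IsNext-suc {j′} {k′} j′<j W≤w₀ (inj₁ (j′<k′ , k′∈𝕆ₑ , gap)) = inj₁ (j′<k′ , k′∈𝕆₁₊ₑ , gap′)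
        where
        k′≤j : k′ ≤ j
        k′≤j = ℕₚ.≮⇒≥ (λ j<k′ → gap _ j′<j j<k′ j∈𝕆ₑ)
        k′∈𝕆₁₊ₑ : In𝕆 n w s w₀ k′ (suc e)
        k′∈𝕆₁₊ₑ with ℕₚ.m≤n⇒m<n∨m≡n k′≤j
        ... | inj₂ refl = j∈𝕆₁₊ₑ
        ... | inj₁ k′<j = stays k′∈𝕆ₑ k′<j
                (ℚₚ.≤-trans (W-mono (s≤s z≤n) (s≤s (ℕₚ.<⇒≤ j′<k′)) ℕₚ.≤-refl 1+e≤n) W≤w₀)
        gap′ : ∀ m → j′ < m → m < k′ → ¬ In𝕆 n w s w₀ m (suc e)
        gap′ m j′<m m<k′ m∈𝕆₁₊ₑ =
          gap m j′<m m<k′ (𝕆-restrict 1+e≤n m∈𝕆₁₊ₑ (ℕₚ.<-≤-trans m<k′ (ℕₚ.≤-trans k′≤j (ℕₚ.<⇒≤ j<e))))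

      Holds-suc : ∀ {j′ k′} → j′ < j → W n w s w₀ (suc j′) (suc e) ≤ℚ w₀ →
                  Holds n w s w₀ j′ k′ e → Holds n w s w₀ j′ k′ (suc e)
      Holds-suc j′<j W≤w₀ (j′∈𝕆ₑ , next) = stays j′∈𝕆ₑ j′<j W≤w₀ , IsNext-suc j′<j W≤w₀ next

    alive⇒holds : ∀ {α t} → IsInstance n w s w₀ α → Alive α t → Holds n w s w₀ (opt α) (nxt α) t
    alive⇒holds (_ , _ , _ , holds , _) (a≤t , t≤e) = holds _ a≤t t≤e

    patient-outlives : ∀ {α α′ i} → IsInstance n w s w₀ α → Alive α i → Alive α′ i →
                       Patient n w s w₀ α′ → opt α ≤ opt α′ → e α ≤ e α′
    patient-outlives {α} {α′} isα@(_ , _ , e≤n , _) (a≤i , _) (_ , i≤e′) patient′ j≤j′ =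
      ℕₚ.≮⇒≥ (dies-first patient′)
      where
      dies-first : Patient n w s w₀ α′ → e α′ < e α → ⊥
      dies-first (inj₁ e′≡n) e′<e = ℕₚ.<⇒≱ e′<e (subst (e α ≤_) (sym e′≡n) e≤n)
      dies-first (inj₂ (e′<n , w₀<W′)) e′<e =
        ℚₚ.<-irrefl refl (ℚₚ.<-≤-trans w₀<W′ (ℚₚ.≤-trans W′≤W W≤w₀))
        where
        W≤w₀ : W n w s w₀ (suc (opt α)) (suc (e α′)) ≤ℚ w₀
        W≤w₀ = proj₂ (proj₁ (proj₁ (alive⇒holds isα (ℕₚ.m≤n⇒m≤1+n (ℕₚ.≤-trans a≤i i≤e′) , e′<e))))
        W′≤W : W n w s w₀ (suc (opt α′)) (suc (e α′)) ≤ℚ W n w s w₀ (suc (opt α)) (suc (e α′))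
        W′≤W = W-mono (s≤s z≤n) (s≤s j≤j′) ℕₚ.≤-refl e′<n

    impatient-outlives : ∀ {α α′ i} → IsInstance n w s w₀ α → IsInstance n w s w₀ α′ →
                         Alive α i → Alive α′ i → Impatient n w s w₀ α′ → opt α′ < opt α → e α ≤ e α′
    impatient-outlives {α} {α′} isα isα′@(_ , _ , _ , _ , _ , exit′) (a≤i , _) (a′≤i , i≤e′) impatient′ j′<j =
      ℕₚ.≮⇒≥ (dies-first exit′)
      where
      a≤e′ : a α ≤ e α′
      a≤e′ = ℕₚ.≤-trans a≤i i≤e′
      dies-first : e α′ ≡ n ⊎ (e α′ < n × ¬ Holds n w s w₀ (opt α′) (nxt α′) (suc (e α′))) →
                   e α′ < e α → ⊥
      dies-first (inj₁ e′≡n) _ = impatient′ (inj₁ e′≡n)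
      dies-first (inj₂ (e′<n , ¬holds′)) e′<e =
        ¬holds′ (Step.Holds-suc e′<n j∈𝕆ₑ′ j∈𝕆₁₊ₑ′ j′<j W′≤w₀ holds′)
        where
        j∈𝕆ₑ′ : In𝕆 n w s w₀ (opt α) (e α′)
        j∈𝕆ₑ′ = proj₁ (alive⇒holds isα (a≤e′ , ℕₚ.<⇒≤ e′<e))
        j∈𝕆₁₊ₑ′ : In𝕆 n w s w₀ (opt α) (suc (e α′))
        j∈𝕆₁₊ₑ′ = proj₁ (alive⇒holds isα (ℕₚ.m≤n⇒m≤1+n a≤e′ , e′<e))
        W′≤w₀ : W n w s w₀ (suc (opt α′)) (suc (e α′)) ≤ℚ w₀
        W′≤w₀ = ℚₚ.≮⇒≥ (λ w₀<W′ → impatient′ (inj₂ (e′<n , w₀<W′)))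
        holds′ : Holds n w s w₀ (opt α′) (nxt α′) (e α′)
        holds′ = alive⇒holds isα′ (ℕₚ.≤-trans a′≤i i≤e′ , ℕₚ.≤-refl)

  outlives⇒dead : ∀ {P α α′ i} → IsInstance n w s w₀ α′ → P α′ → Alive α′ i → opt α′ ≢ opt α →
                  cost n w s w₀ α′ ≤∞ cost n w s w₀ α → e α ≤ e α′ → DeadAmong n w s w₀ P α i
  outlives⇒dead isα′ pα′ alive′ opt≢ cost≤ e≤e′ = _ , isα′ , pα′ , alive′ , opt≢ ∘ proj₁ , cost≤ , e≤e′

lemma2 : (n : ℕ) (w s : ℕ → ℚ) (w₀ : ℚ)
    → (∀ v → 1 ≤ v → v ≤ n → 0ℚ ≤ℚ w v)
    → (∀ v → 1 ≤ v → v ≤ n → 0ℚ ≤ℚ s v)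
    → (i : ℕ) → 1 ≤ i → i ≤ n
    → ((α α′ : Instance)
        → IsInstance n w s w₀ α → IsInstance n w s w₀ α′
        → Alive α i → Alive α′ i
        → Patient n w s w₀ α → Patient n w s w₀ α′
        → opt α < opt α′
        → cost n w s w₀ α′ ≤∞ cost n w s w₀ α
        → e α ≤ e α′ × DeadAmong n w s w₀ (Patient n w s w₀) α i)
    × ((α α′ : Instance)
        → IsInstance n w s w₀ α → IsInstance n w s w₀ α′
        → Alive α i → Alive α′ i
        → Impatient n w s w₀ α → Impatient n w s w₀ α′
        → opt α′ < opt α
        → cost n w s w₀ α′ ≤∞ cost n w s w₀ α
        → e α ≤ e α′ × DeadAmong n w s w₀ (Impatient n w s w₀) α i)
lemma2 n w s w₀ w≥0 _ i _ _ =
    (λ α α′ isα isα′ alive alive′ _ patient′ j<j′ cost≤ →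
       let e≤e′ = patient-outlives w≥0 {α′ = α′} isα alive alive′ patient′ (ℕₚ.<⇒≤ j<j′)
       in e≤e′ , outlives⇒dead {Patient n w s w₀} isα′ patient′ alive′ (ℕₚ.>⇒≢ j<j′) cost≤ e≤e′)
  , (λ α α′ isα isα′ alive alive′ _ impatient′ j′<j cost≤ →
       let e≤e′ = impatient-outlives w≥0 {α′ = α′} isα isα′ alive alive′ impatient′ j′<j
       in e≤e′ , outlives⇒dead {Impatient n w s w₀} isα′ impatient′ alive′ (ℕₚ.<⇒≢ j′<j) cost≤ e≤e′)
  where open Instances n w s w₀
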